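{- Let $m,p \in \mathbb{N}$ with $p > m+1$, and define $A \coloneqq [0,m] \cup \{p\}$, where $[0,m]=\{0,1,\dots,m\}$. Then $A$ is a More Differences Than Sums (MDTS) set, i.e. $|A-A| > |A+A|$, and moreover $$ |A-A| - |A+A| \ = \ \begin{cases} m, & \text{if } p > 2m, \\ p - m - 1, & \text{if } m+1 < p \leq 2m. \end{cases} $$
   Context: For a finite set of integers $A$, $A+A=\{a+b: a,b\in A\}$ and $A-A=\{a-b: a,b\in A\}$; $|X|$ denotes cardinality. For integers $x\le y$, $[x,y]$ denotes the set of integers $\{x,x+1,\dots,y\}$. A finite set $A$ is MDTS if $|A-A|>|A+A|$. -}

module Defs where

open import Data.Nat using (ℕ; suc)
open import Data.Integer using (ℤ; +_; _+_; _-_; _≟_)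
open import Data.List using (List; _∷_; []; map; upTo; _++_; length; deduplicate; cartesianProductWith)

-- Finite sets of integers are represented by lists (duplicates allowed);
-- the cardinality of the represented set is the number of distinct entries.
card : List ℤ → ℕ
card xs = length (deduplicate _≟_ xs)

sumset : List ℤ → List ℤ
sumset A = cartesianProductWith _+_ A A

diffset : List ℤ → List ℤ
diffset A = cartesianProductWith _-_ A A

interval0 : ℕ → List ℤ
interval0 m = map +_ (upTo (suc m))

setA : ℕ → ℕ → List ℤ
setA m p = interval0 m ++ (+ p ∷ [])

MDTS : List ℤ → Set
MDTS A = card (sumset A) Data.Nat.< card (diffset A)

-- For p > 2m the sums and the differences (shifted by p) split into disjoint intervals,
--   A + A = [0, 2m] ∪ [p, p + m] ∪ {2p}                    (3m + 3 elements),
--   A − A + p = [0, m] ∪ [p − m, p + m] ∪ [2p − m, 2p]     (4m + 3 elements),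
-- while for m + 1 < p ≤ 2m the first intervals merge: A + A = [0, p + m] ∪ {2p} and
-- A − A = [−p, p] have p + m + 2 and 2p + 1 elements. Each cardinality is computed by
-- exhibiting a duplicate-free list with the same elements as the set.

module Submission where

open import Defs
open import Algebra.Bundles using (AbelianGroup)
open import Data.Integer as ℤ using (ℤ; -_; _⊖_)
import Data.Integer.Properties as ℤ
open import Algebra.Properties.Group (AbelianGroup.group ℤ.+-0-abelianGroup) using (∙-cancelˡ)
open import Data.Nat using (ℕ; suc; _+_; _∸_; _<_; _≤_; _*_; z≤n; s≤s; s≤s⁻¹; _≤?_; _<?_)
open import Data.Nat.Properties
open import Data.Nat.Tactic.RingSolver using (solve-∀)
open import Data.Product using (_×_; _,_; ∃; ∃₂; proj₁; proj₂; uncurry; map₂)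
open import Data.Sum using (_⊎_; inj₁; inj₂)
open import Data.List using (List; [_]; map; upTo; _++_; length; cartesianProductWith)
open import Data.List.Properties using (length-++; length-map; length-upTo)
open import Data.List.Membership.Propositional using (_∈_)
open import Data.List.Membership.Propositional.Properties
open import Data.List.Membership.Propositional.Properties.WithK using (unique∧set⇒bag)
open import Data.List.Relation.Binary.BagAndSetEquality using (_∼[_]_; set; ∼bag⇒↭)
open import Data.List.Relation.Binary.Permutation.Propositional.Properties using (↭-length)
open import Data.List.Relation.Unary.All as All using (All; []; _∷_)
open import Data.List.Relation.Unary.All.Properties using () renaming (++⁺ to All-++⁺)
open import Data.List.Relation.Unary.Any using (here)
open import Data.List.Relation.Unary.AllPairs using ([]; _∷_)
open import Data.List.Relation.Unary.Unique.Propositional using (Unique)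
import Data.List.Relation.Unary.Unique.Propositional.Properties as Unique
open import Data.List.Relation.Unary.Unique.DecPropositional.Properties ℤ._≟_ using (deduplicate-!)
open import Function using (_∘_)
open import Function.Bundles using (_⇔_; mk⇔; Equivalence)
open import Function.Definitions using (Injective)
open import Relation.Binary.PropositionalEquality
  using (_≡_; refl; sym; trans; cong; cong₂; subst; module ≡-Reasoning)
open import Relation.Nullary using (yes; no)

open Equivalence using (to; from)

card≡length : ∀ {xs ys} → Unique ys → xs ∼[ set ] ys → card xs ≡ length ys
card≡length {xs} uys xs∼ys =
  ↭-length (∼bag⇒↭ (unique∧set⇒bag (deduplicate-! xs) uys
    (mk⇔ (to xs∼ys ∘ ∈-deduplicate⁻ ℤ._≟_ xs) (∈-deduplicate⁺ ℤ._≟_ ∘ from xs∼ys))))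

card-image : ∀ {P : ℕ → Set} {g : ℕ → ℤ} {xs : List ℤ} {ks : List ℕ} →
  Injective _≡_ _≡_ g → Unique ks →
  (∀ {z} → z ∈ xs ⇔ ∃ λ k → P k × z ≡ g k) → (∀ {k} → k ∈ ks ⇔ P k) →
  card xs ≡ length ks
card-image {g = g} {ks = ks} inj uks xs⇔ ks⇔ =
  trans (card≡length (Unique.map⁺ inj uks) (mk⇔ into onto)) (length-map g ks)
  where
  into : ∀ {z} → z ∈ _ → z ∈ map g ks
  into z∈ with to xs⇔ z∈
  ... | k , Pk , refl = ∈-map⁺ g (from ks⇔ Pk)
  onto : ∀ {z} → z ∈ map g ks → z ∈ _
  onto z∈ with ∈-map⁻ g z∈
  ... | k , k∈ , refl = from xs⇔ (k , to ks⇔ k∈ , refl)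

segment : ℕ → ℕ → List ℕ
segment a w = map (a +_) (upTo (suc w))

length-segment : ∀ a w → length (segment a w) ≡ suc w
length-segment a w = trans (length-map (a +_) (upTo (suc w))) (length-upTo (suc w))

∈-segment⁺ : ∀ {a w k} → a ≤ k → k ≤ a + w → k ∈ segment a w
∈-segment⁺ {a} {w} {k} a≤k k≤a+w =
  subst (_∈ segment a w) (m+[n∸m]≡n a≤k) (∈-map⁺ (a +_) (∈-upTo⁺ (s≤s (m≤n+o⇒m∸n≤o k a k≤a+w))))

∈-segment⁻ : ∀ {a w k} → k ∈ segment a w → a ≤ k × k ≤ a + w
∈-segment⁻ {a} k∈ with ∈-map⁻ (a +_) k∈
... | i , i∈ , refl = m≤m+n a i , +-monoʳ-≤ a (s≤s⁻¹ (∈-upTo⁻ i∈))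

segment-lowerBound : ∀ {b a w} → b ≤ a → All (b ≤_) (segment a w)
segment-lowerBound b≤a = All.tabulate (λ k∈ → ≤-trans b≤a (proj₁ (∈-segment⁻ k∈)))

segment-unique : ∀ a w → Unique (segment a w)
segment-unique a w = Unique.map⁺ (+-cancelˡ-≡ a _ _) (Unique.upTo⁺ (suc w))

segment-++-unique : ∀ {a w b ks} → a + w < b → All (b ≤_) ks → Unique ks → Unique (segment a w ++ ks)
segment-++-unique {a} {w} lt bounded uks = Unique.++⁺ (segment-unique a w) uks
  λ (k∈seg , k∈ks) →
    <-irrefl refl (≤-<-trans (proj₂ (∈-segment⁻ k∈seg)) (<-≤-trans lt (All.lookup bounded k∈ks)))

length-segment-++ : ∀ a w ks → length (segment a w ++ ks) ≡ suc w + length ks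
length-segment-++ a w ks = trans (length-++ (segment a w)) (cong (_+ length ks) (length-segment a w))

m∸n≤o⇒m∸o≤n : ∀ {m n o} → m ∸ n ≤ o → m ∸ o ≤ n
m∸n≤o⇒m∸o≤n {m} {n} {o} m∸n≤o =
  m≤n+o⇒m∸n≤o m o (≤-trans (m≤n+m∸n m n) (≤-trans (+-monoʳ-≤ n m∸n≤o) (≤-reflexive (+-comm n o))))

m+[n∸n]≡m : ∀ m n → m + (n ∸ n) ≡ m
m+[n∸n]≡m m n = trans (cong (m +_) (n∸n≡0 n)) (+-identityʳ m)

m≡n+o⇒o<m×m∸o≡n : ∀ {m n o} → 1 ≤ n → m ≡ n + o → o < m × m ∸ o ≡ n
m≡n+o⇒o<m×m∸o≡n {n = n} {o} 1≤n refl = +-monoˡ-≤ o 1≤n , m+n∸n≡m n o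

module _ (m p : ℕ) where

  InA : ℕ → Set
  InA a = a ≤ m ⊎ a ≡ p

  MDTSBy : ℕ → Set
  MDTSBy d = MDTS (setA m p) × card (diffset (setA m p)) ∸ card (sumset (setA m p)) ≡ d

  IsSum : ℕ → Set
  IsSum k = ∃₂ λ a b → InA a × InA b × a + b ≡ k

  -- k = a − b + p: shifting by p keeps the differences in ℕ, and b ≤ p makes the truncated p ∸ b exact
  IsShiftedDiff : ℕ → Set
  IsShiftedDiff k = ∃₂ λ a b → InA a × InA b × a + (p ∸ b) ≡ k

  ∈-setA : ∀ {z} → z ∈ setA m p ⇔ ∃ λ a → InA a × z ≡ ℤ.+ a
  ∈-setA = mk⇔ into onto
    where
    into : ∀ {z} → z ∈ setA m p → ∃ λ a → InA a × z ≡ ℤ.+ a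
    into z∈ with ∈-++⁻ (interval0 m) z∈
    ... | inj₂ (here refl) = p , inj₂ refl , refl
    ... | inj₁ z∈[0,m] with ∈-map⁻ ℤ.+_ z∈[0,m]
    ...   | a , a∈ , refl = a , inj₁ (s≤s⁻¹ (∈-upTo⁻ a∈)) , refl
    onto : ∀ {z} → (∃ λ a → InA a × z ≡ ℤ.+ a) → z ∈ setA m p
    onto (a , inj₁ a≤m , refl) = ∈-++⁺ˡ (∈-map⁺ ℤ.+_ (∈-upTo⁺ (s≤s a≤m)))
    onto (a , inj₂ refl , refl) = ∈-++⁺ʳ (interval0 m) (here refl)

  PairOf : (ℤ → ℤ → ℤ) → ℤ → Set
  PairOf f z = ∃₂ λ a b → InA a × InA b × z ≡ f (ℤ.+ a) (ℤ.+ b)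

  ∈-setA-pairs : ∀ {f z} → z ∈ cartesianProductWith f (setA m p) (setA m p) ⇔ PairOf f z
  ∈-setA-pairs {f} = mk⇔ into onto
    where
    into : ∀ {z} → z ∈ cartesianProductWith f (setA m p) (setA m p) → PairOf f z
    into z∈ with ∈-cartesianProductWith⁻ f (setA m p) (setA m p) z∈
    ... | x , y , x∈ , y∈ , refl with to ∈-setA x∈ | to ∈-setA y∈
    ...   | a , a∈A , refl | b , b∈A , refl = a , b , a∈A , b∈A , refl
    onto : ∀ {z} → PairOf f z → z ∈ cartesianProductWith f (setA m p) (setA m p)
    onto (a , b , a∈A , b∈A , refl) =
      ∈-cartesianProductWith⁺ f (from ∈-setA (a , a∈A , refl)) (from ∈-setA (b , b∈A , refl))

  ∈-sumset : ∀ {z} → z ∈ sumset (setA m p) ⇔ ∃ λ k → IsSum k × z ≡ ℤ.+ k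
  ∈-sumset = mk⇔
    (λ z∈ → let (a , b , a∈A , b∈A , z≡) = to ∈-setA-pairs z∈
            in a + b , (a , b , a∈A , b∈A , refl) , trans z≡ (sym (ℤ.pos-+ a b)))
    λ { (_ , (a , b , a∈A , b∈A , refl) , refl) → from ∈-setA-pairs (a , b , a∈A , b∈A , ℤ.pos-+ a b) }

  shift : ℕ → ℤ
  shift k = - ℤ.+ p ℤ.+ ℤ.+ k

  shift-injective : Injective _≡_ _≡_ shift
  shift-injective eq = ℤ.+-injective (∙-cancelˡ (- ℤ.+ p) _ _ eq)

  diff≡shift : ∀ {a b} → b ≤ p → ℤ.+ a ℤ.- ℤ.+ b ≡ shift (a + (p ∸ b))
  diff≡shift {a} {b} b≤p = begin
    ℤ.+ a ℤ.- ℤ.+ b              ≡⟨ ℤ.[+m]-[+n]≡m⊖n a b ⟩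
    a ⊖ b                        ≡⟨ ℤ.+-cancelˡ-⊖ (p ∸ b) a b ⟨
    (p ∸ b) + a ⊖ ((p ∸ b) + b)  ≡⟨ cong₂ _⊖_ (+-comm (p ∸ b) a) (m∸n+n≡m b≤p) ⟩
    a + (p ∸ b) ⊖ p              ≡⟨ ℤ.-m+n≡n⊖m p (a + (p ∸ b)) ⟨
    shift (a + (p ∸ b))          ∎
    where open ≡-Reasoning

  InA⇒≤p : m ≤ p → ∀ {a} → InA a → a ≤ p
  InA⇒≤p m≤p (inj₁ a≤m) = ≤-trans a≤m m≤p
  InA⇒≤p m≤p (inj₂ refl) = ≤-refl

  ∈-diffset : m ≤ p → ∀ {z} → z ∈ diffset (setA m p) ⇔ ∃ λ k → IsShiftedDiff k × z ≡ shift k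
  ∈-diffset m≤p = mk⇔
    (λ z∈ → let (a , b , a∈A , b∈A , z≡) = to ∈-setA-pairs z∈
            in a + (p ∸ b) , (a , b , a∈A , b∈A , refl) , trans z≡ (diff≡shift (InA⇒≤p m≤p b∈A)))
    λ { (_ , (a , b , a∈A , b∈A , refl) , refl) →
          from ∈-setA-pairs (a , b , a∈A , b∈A , sym (diff≡shift (InA⇒≤p m≤p b∈A))) }

  sum-≤2m : ∀ {k} → k ≤ m + m → IsSum k
  sum-≤2m {k} k≤2m with k ≤? m
  ... | yes k≤m = k , 0 , inj₁ k≤m , inj₁ z≤n , +-identityʳ k
  ... | no k≰m = m , k ∸ m , inj₁ ≤-refl , inj₁ (m≤n+o⇒m∸n≤o k m k≤2m) , m+[n∸m]≡n (<⇒≤ (≰⇒> k≰m))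

  sum-p+ : ∀ {k} → p ≤ k → k ≤ p + m → IsSum k
  sum-p+ {k} p≤k k≤p+m = k ∸ p , p , inj₁ (m≤n+o⇒m∸n≤o k p k≤p+m) , inj₂ refl , m∸n+n≡m p≤k

  sum-2p : IsSum (p + p)
  sum-2p = p , p , inj₂ refl , inj₂ refl , refl

  shiftedDiff-≤m : ∀ {k} → k ≤ m → IsShiftedDiff k
  shiftedDiff-≤m {k} k≤m = k , p , inj₁ k≤m , inj₂ refl , m+[n∸n]≡m k p

  shiftedDiff-mid : ∀ {k} → p ∸ m ≤ k → k ≤ p + m → IsShiftedDiff k
  shiftedDiff-mid {k} p∸m≤k k≤p+m with k <? p
  ... | yes k<p = 0 , p ∸ k , inj₁ z≤n , inj₁ (m∸n≤o⇒m∸o≤n p∸m≤k) , m∸[m∸n]≡n (<⇒≤ k<p)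
  ... | no k≮p = k ∸ p , 0 , inj₁ (m≤n+o⇒m∸n≤o k p k≤p+m) , inj₁ z≤n , m∸n+n≡m (≮⇒≥ k≮p)

  shiftedDiff-high : ∀ {k} → p + (p ∸ m) ≤ k → k ≤ p + p → IsShiftedDiff k
  shiftedDiff-high {k} lo hi = p , p ∸ (k ∸ p) , inj₂ refl , inj₁ (m∸n≤o⇒m∸o≤n p∸m≤k∸p) , eq
    where
    p≤k : p ≤ k
    p≤k = ≤-trans (m≤m+n p (p ∸ m)) lo
    p∸m≤k∸p : p ∸ m ≤ k ∸ p
    p∸m≤k∸p = m+n≤o⇒m≤o∸n (p ∸ m) (≤-trans (≤-reflexive (+-comm (p ∸ m) p)) lo)
    eq : p + (p ∸ (p ∸ (k ∸ p))) ≡ k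
    eq = trans (cong (p +_) (m∸[m∸n]≡n (m≤n+o⇒m∸n≤o k p hi))) (m+[n∸m]≡n p≤k)

  module Far (far : m + m < p) where

    m<p : m < p
    m<p = ≤-<-trans (m≤m+n m m) far

    m≤p : m ≤ p
    m≤p = <⇒≤ m<p

    sums : List ℕ
    sums = segment 0 (m + m) ++ segment p m ++ [ p + p ]

    sums-unique : Unique sums
    sums-unique = segment-++-unique far (All-++⁺ (segment-lowerBound ≤-refl) (m≤m+n p p ∷ []))
      (segment-++-unique (+-monoʳ-< p m<p) (≤-refl ∷ []) ([] ∷ []))

    sum∈sums : ∀ {a b} → InA a → InA b → a + b ∈ sums
    sum∈sums (inj₁ a≤m) (inj₁ b≤m) = ∈-++⁺ˡ (∈-segment⁺ z≤n (+-mono-≤ a≤m b≤m))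
    sum∈sums {b = b} (inj₂ refl) (inj₁ b≤m) =
      ∈-++⁺ʳ (segment 0 (m + m)) (∈-++⁺ˡ (∈-segment⁺ (m≤m+n p b) (+-monoʳ-≤ p b≤m)))
    sum∈sums {a} (inj₁ a≤m) (inj₂ refl) = subst (_∈ sums) (+-comm p a) (sum∈sums (inj₂ refl) (inj₁ a≤m))
    sum∈sums (inj₂ refl) (inj₂ refl) = ∈-++⁺ʳ (segment 0 (m + m)) (∈-++⁺ʳ (segment p m) (here refl))

    ∈-sums : ∀ {k} → k ∈ sums ⇔ IsSum k
    ∈-sums = mk⇔ into λ { (_ , _ , a∈A , b∈A , refl) → sum∈sums a∈A b∈A }
      where
      into : ∀ {k} → k ∈ sums → IsSum k
      into k∈ with ∈-++⁻ (segment 0 (m + m)) k∈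
      ... | inj₁ k∈low = sum-≤2m (proj₂ (∈-segment⁻ k∈low))
      ... | inj₂ k∈high with ∈-++⁻ (segment p m) k∈high
      ...   | inj₁ k∈mid = uncurry sum-p+ (∈-segment⁻ k∈mid)
      ...   | inj₂ (here refl) = sum-2p

    card-sumset : card (sumset (setA m p)) ≡ suc (m + m) + (suc m + 1)
    card-sumset = begin
      card (sumset (setA m p))  ≡⟨ card-image ℤ.+-injective sums-unique ∈-sumset ∈-sums ⟩
      length sums               ≡⟨ length-segment-++ 0 (m + m) _ ⟩
      suc (m + m) + length (segment p m ++ [ p + p ])
                                ≡⟨ cong (suc (m + m) +_) (length-segment-++ p m _) ⟩
      suc (m + m) + (suc m + 1) ∎
      where open ≡-Reasoning

    diffs : List ℕ
    diffs = segment 0 m ++ segment (p ∸ m) (m + m) ++ segment (p + (p ∸ m)) m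

    mid-end : p ∸ m + (m + m) ≡ p + m
    mid-end = trans (sym (+-assoc (p ∸ m) m m)) (cong (_+ m) (m∸n+n≡m m≤p))

    top-end : p + (p ∸ m) + m ≡ p + p
    top-end = trans (+-assoc p (p ∸ m) m) (cong (p +_) (m∸n+n≡m m≤p))

    diffs-unique : Unique diffs
    diffs-unique = segment-++-unique m<p∸m
      (All-++⁺ (segment-lowerBound ≤-refl) (segment-lowerBound (m≤n+m (p ∸ m) p)))
      (segment-++-unique mid<top (segment-lowerBound ≤-refl) (segment-unique (p + (p ∸ m)) m))
      where
      m<p∸m : m < p ∸ m
      m<p∸m = m+n≤o⇒m≤o∸n (suc m) far
      mid<top : p ∸ m + (m + m) < p + (p ∸ m)
      mid<top = subst (_< p + (p ∸ m)) (sym mid-end) (+-monoʳ-< p m<p∸m)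

    shiftedDiff∈diffs : ∀ {a b} → InA a → InA b → a + (p ∸ b) ∈ diffs
    shiftedDiff∈diffs {a} (inj₁ a≤m) (inj₂ refl) =
      subst (_∈ diffs) (sym (m+[n∸n]≡m a p)) (∈-++⁺ˡ (∈-segment⁺ z≤n a≤m))
    shiftedDiff∈diffs {a} {b} (inj₁ a≤m) (inj₁ b≤m) = ∈-++⁺ʳ (segment 0 m) (∈-++⁺ˡ (∈-segment⁺
      (≤-trans (∸-monoʳ-≤ p b≤m) (m≤n+m (p ∸ b) a))
      (≤-trans (+-mono-≤ a≤m (m∸n≤m p b)) (≤-reflexive (trans (+-comm m p) (sym mid-end))))))
    shiftedDiff∈diffs (inj₂ refl) (inj₂ refl) = subst (_∈ diffs) (sym (m+[n∸n]≡m p p))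
      (∈-++⁺ʳ (segment 0 m) (∈-++⁺ˡ
        (∈-segment⁺ (m∸n≤m p m) (≤-trans (m≤m+n p m) (≤-reflexive (sym mid-end))))))
    shiftedDiff∈diffs {b = b} (inj₂ refl) (inj₁ b≤m) =
      ∈-++⁺ʳ (segment 0 m) (∈-++⁺ʳ (segment (p ∸ m) (m + m)) (∈-segment⁺
        (+-monoʳ-≤ p (∸-monoʳ-≤ p b≤m))
        (≤-trans (+-monoʳ-≤ p (m∸n≤m p b)) (≤-reflexive (sym top-end)))))

    ∈-diffs : ∀ {k} → k ∈ diffs ⇔ IsShiftedDiff k
    ∈-diffs = mk⇔ into λ { (_ , _ , a∈A , b∈A , refl) → shiftedDiff∈diffs a∈A b∈A }
      where
      into : ∀ {k} → k ∈ diffs → IsShiftedDiff k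
      into k∈ with ∈-++⁻ (segment 0 m) k∈
      ... | inj₁ k∈low = shiftedDiff-≤m (proj₂ (∈-segment⁻ k∈low))
      ... | inj₂ k∈high with ∈-++⁻ (segment (p ∸ m) (m + m)) k∈high
      ...   | inj₁ k∈mid = let (lo , hi) = ∈-segment⁻ k∈mid in
        shiftedDiff-mid lo (≤-trans hi (≤-reflexive mid-end))
      ...   | inj₂ k∈top = let (lo , hi) = ∈-segment⁻ k∈top in
        shiftedDiff-high lo (≤-trans hi (≤-reflexive top-end))

    card-diffset : card (diffset (setA m p)) ≡ suc m + (suc (m + m) + suc m)
    card-diffset = begin
      card (diffset (setA m p))  ≡⟨ card-image shift-injective diffs-unique (∈-diffset m≤p) ∈-diffs ⟩
      length diffs               ≡⟨ length-segment-++ 0 m _ ⟩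
      suc m + length (segment (p ∸ m) (m + m) ++ segment (p + (p ∸ m)) m)
                                 ≡⟨ cong (suc m +_) (length-segment-++ (p ∸ m) (m + m) _) ⟩
      suc m + (suc (m + m) + length (segment (p + (p ∸ m)) m))
                                 ≡⟨ cong (λ n → suc m + (suc (m + m) + n)) (length-segment (p + (p ∸ m)) m) ⟩
      suc m + (suc (m + m) + suc m) ∎
      where open ≡-Reasoning

    mdtsBy-m : 1 ≤ m → MDTSBy m
    mdtsBy-m 1≤m = m≡n+o⇒o<m×m∸o≡n 1≤m (begin
      card (diffset (setA m p))         ≡⟨ card-diffset ⟩
      suc m + (suc (m + m) + suc m)     ≡⟨ regroup m ⟩
      m + (suc (m + m) + (suc m + 1))   ≡⟨ cong (m +_) card-sumset ⟨
      m + card (sumset (setA m p))      ∎)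
      where
      open ≡-Reasoning
      regroup : ∀ n → suc n + (suc (n + n) + suc n) ≡ n + (suc (n + n) + (suc n + 1))
      regroup = solve-∀

  module Near (m<p : m < p) (near : p ≤ m + m) where

    m≤p : m ≤ p
    m≤p = <⇒≤ m<p

    sums : List ℕ
    sums = segment 0 (p + m) ++ [ p + p ]

    sums-unique : Unique sums
    sums-unique = segment-++-unique (+-monoʳ-< p m<p) (≤-refl ∷ []) ([] ∷ [])

    sum∈sums : ∀ {a b} → InA a → InA b → a + b ∈ sums
    sum∈sums (inj₁ a≤m) (inj₁ b≤m) = ∈-++⁺ˡ (∈-segment⁺ z≤n (+-mono-≤ (≤-trans a≤m m≤p) b≤m))
    sum∈sums (inj₂ refl) (inj₁ b≤m) = ∈-++⁺ˡ (∈-segment⁺ z≤n (+-monoʳ-≤ p b≤m))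
    sum∈sums {a} (inj₁ a≤m) (inj₂ refl) = subst (_∈ sums) (+-comm p a) (sum∈sums (inj₂ refl) (inj₁ a≤m))
    sum∈sums (inj₂ refl) (inj₂ refl) = ∈-++⁺ʳ (segment 0 (p + m)) (here refl)

    ∈-sums : ∀ {k} → k ∈ sums ⇔ IsSum k
    ∈-sums = mk⇔ into λ { (_ , _ , a∈A , b∈A , refl) → sum∈sums a∈A b∈A }
      where
      into : ∀ {k} → k ∈ sums → IsSum k
      into {k} k∈ with ∈-++⁻ (segment 0 (p + m)) k∈ | k <? p
      ... | inj₁ k∈low | yes k<p = sum-≤2m (≤-trans (<⇒≤ k<p) near)
      ... | inj₁ k∈low | no k≮p = sum-p+ (≮⇒≥ k≮p) (proj₂ (∈-segment⁻ k∈low))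
      ... | inj₂ (here refl) | _ = sum-2p

    diffs : List ℕ
    diffs = segment 0 (p + p)

    ∈-diffs : ∀ {k} → k ∈ diffs ⇔ IsShiftedDiff k
    ∈-diffs = mk⇔ into λ { (a , b , a∈A , b∈A , refl) →
      ∈-segment⁺ z≤n (+-mono-≤ (InA⇒≤p m≤p a∈A) (m∸n≤m p b)) }
      where
      p∸m≤m : p ∸ m ≤ m
      p∸m≤m = m≤n+o⇒m∸n≤o p m near
      into : ∀ {k} → k ∈ diffs → IsShiftedDiff k
      into {k} k∈ with k ≤? m | k ≤? p + m
      ... | yes k≤m | _ = shiftedDiff-≤m k≤m
      ... | no k≰m | yes k≤p+m = shiftedDiff-mid (≤-trans p∸m≤m (<⇒≤ (≰⇒> k≰m))) k≤p+m
      ... | no _ | no k≰p+m =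
        shiftedDiff-high (≤-trans (+-monoʳ-≤ p p∸m≤m) (<⇒≤ (≰⇒> k≰p+m))) (proj₂ (∈-segment⁻ k∈))

    mdtsBy-p∸m∸1 : suc m < p → MDTSBy (p ∸ m ∸ 1)
    mdtsBy-p∸m∸1 1+m<p =
      map₂ (λ eq → trans eq (sym ∸-∸-1)) (m≡n+o⇒o<m×m∸o≡n (m<n⇒0<n∸m 1+m<p) (begin
      card (diffset (setA m p))  ≡⟨ card-image shift-injective (segment-unique 0 (p + p)) (∈-diffset m≤p) ∈-diffs ⟩
      length diffs               ≡⟨ length-segment 0 (p + p) ⟩
      suc (p + p)                ≡⟨ subst (λ q → suc (q + q) ≡ d + (suc (q + m) + 1))
                                          (m+[n∸m]≡n (<⇒≤ 1+m<p)) (regroup m d) ⟩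
      d + (suc (p + m) + 1)      ≡⟨ cong (d +_) (length-segment-++ 0 (p + m) _) ⟨
      d + length sums            ≡⟨ cong (d +_) (card-image ℤ.+-injective sums-unique ∈-sumset ∈-sums) ⟨
      d + card (sumset (setA m p)) ∎))
      where
      open ≡-Reasoning
      d : ℕ
      d = p ∸ suc m
      ∸-∸-1 : p ∸ m ∸ 1 ≡ d
      ∸-∸-1 = trans (∸-+-assoc p m 1) (cong (p ∸_) (+-comm m 1))
      regroup : ∀ n e → suc (suc n + e + (suc n + e)) ≡ e + (suc (suc n + e + n) + 1)
      regroup = solve-∀

theorem2p4 : (m p : ℕ) → 1 ≤ m → suc m < p →
    MDTS (setA m p)
    × (2 * m < p → card (diffset (setA m p)) ∸ card (sumset (setA m p)) ≡ m)
    × (p ≤ 2 * m → card (diffset (setA m p)) ∸ card (sumset (setA m p)) ≡ p ∸ m ∸ 1)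
theorem2p4 m p 1≤m 1+m<p = mdts , proj₂ ∘ far ∘ subst (_< p) 2m≡m+m , proj₂ ∘ near ∘ subst (p ≤_) 2m≡m+m
  where
  2m≡m+m : 2 * m ≡ m + m
  2m≡m+m = cong (m +_) (+-identityʳ m)
  far : m + m < p → MDTSBy m p m
  far 2m<p = Far.mdtsBy-m m p 2m<p 1≤m
  near : p ≤ m + m → MDTSBy m p (p ∸ m ∸ 1)
  near p≤2m = Near.mdtsBy-p∸m∸1 m p (<-trans (n<1+n m) 1+m<p) p≤2m 1+m<p
  mdts : MDTS (setA m p)
  mdts with m + m <? p
  ... | yes 2m<p = proj₁ (far 2m<p)
  ... | no 2m≮p = proj₁ (near (≮⇒≥ 2m≮p))
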